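{- For $f=f_{\mathbb Q}$ and all $a,b\in\mathbb F_{\hat p}$: $f(a+b)\le2f(a)f(b)$, $f(ab)\le f(a)f(b)$, $f(-a)=f(a)$, and if $a\ne0$ then $f(a^{ -1})=f(a)$.
   Context: ${}^*\mathbb N=\mathbb N^I/\mathcal F$ is an ultrapower of $\mathbb N$ by a countably incomplete ultrafilter. $\hat p\in{}^*\mathbb N\setminus\mathbb N$ is a nonstandard prime and $\mathbb F_{\hat p}=\{\hat n\in{}^*\mathbb N:\hat n<\hat p\}$ with operations modulo $\hat p$. For $x\in\mathbb F_{\hat p}$, $f_{\mathbb Q}(x)$ is the minimum of $\max(n,m)$ over all $n,m\in{}^*\mathbb N$ with $m\not\equiv0\pmod{\hat p}$ and $x\equiv n/m$ or $x\equiv-n/m\pmod{\hat p}$. -}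

module Defs where

open import Data.Nat using (ℕ; _+_; _*_; _∸_; _≤_; _<_; _⊔_)
open import Data.Nat.Divisibility using (_∣_)
open import Data.Nat.Primality using (Prime)
open import Data.Product using (Σ; _×_)
open import Data.Sum using (_⊎_)
open import Data.Unit using (⊤)
open import Data.Empty using (⊥)
open import Relation.Nullary using (¬_)
open import Relation.Binary.PropositionalEquality using (_≡_)

record Ultrafilter (I : Set) : Set₁ where
  field
    U      : (I → Set) → Set
    full   : U (λ _ → ⊤)
    proper : ¬ U (λ _ → ⊥)
    mono   : ∀ {P Q : I → Set} → (∀ i → P i → Q i) → U P → U Q
    inter  : ∀ {P Q : I → Set} → U P → U Q → U (λ i → P i × Q i)
    ultra  : ∀ (P : I → Set) → U P ⊎ U (λ i → ¬ P i)

open Ultrafilter public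

CountablyIncomplete : {I : Set} → Ultrafilter I → Set₁
CountablyIncomplete {I} F =
  Σ (ℕ → I → Set) λ A → (∀ n → U F (A n)) × (∀ i → Σ ℕ λ n → ¬ A n i)

-- Congruence modulo q in ℕ (meaningful for every q, including 0).
Cong : ℕ → ℕ → ℕ → Set
Cong q a b = Σ ℕ λ k → Σ ℕ λ l → a + k * q ≡ b + l * q

-- Elements of *ℕ = ℕ^I / F are represented by functions I → ℕ;
-- internal relations hold iff they hold on a set in F.
module Ultrapower {I : Set} (F : Ultrafilter I) where

  *ℕ : Set
  *ℕ = I → ℕ

  _≈*_ : *ℕ → *ℕ → Set
  x ≈* y = U F (λ i → x i ≡ y i)

  _≤*_ : *ℕ → *ℕ → Set
  x ≤* y = U F (λ i → x i ≤ y i)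

  _<*_ : *ℕ → *ℕ → Set
  x <* y = U F (λ i → x i < y i)

  _+*_ : *ℕ → *ℕ → *ℕ
  (x +* y) i = x i + y i

  _**_ : *ℕ → *ℕ → *ℕ
  (x ** y) i = x i * y i

  _∸*_ : *ℕ → *ℕ → *ℕ
  (x ∸* y) i = x i ∸ y i

  const : ℕ → *ℕ
  const k _ = k

  CongP : *ℕ → *ℕ → *ℕ → Set
  CongP p x y = U F (λ i → Cong (p i) (x i) (y i))

  NonZeroMod : *ℕ → *ℕ → Set
  NonZeroMod p m = ¬ U F (λ i → p i ∣ m i)

  -- x ≡ n/m  or  x ≡ -n/m  (mod p̂), i.e. x·m ≡ n or x·m + n ≡ 0.
  RatRep : *ℕ → *ℕ → *ℕ → *ℕ → Set
  RatRep p x n m = CongP p (x ** m) n ⊎ CongP p ((x ** m) +* n) (const 0)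

  -- IsFQ p x v :  f_ℚ(x) = v, i.e. v is the minimum of max(n,m) over all
  -- n, m ∈ *ℕ with m ≢ 0 (mod p̂) and x ≡ ±n/m (mod p̂).
  IsFQ : *ℕ → *ℕ → *ℕ → Set
  IsFQ p x v =
    (Σ *ℕ λ n → Σ *ℕ λ m →
        NonZeroMod p m × RatRep p x n m × (v ≈* (λ i → n i ⊔ m i)))
    × (∀ (n m : *ℕ) → NonZeroMod p m → RatRep p x n m → v ≤* (λ i → n i ⊔ m i))

  NonstandardPrime : *ℕ → Set
  NonstandardPrime p = U F (λ i → Prime (p i)) × (∀ (k : ℕ) → ¬ (p ≈* const k))

  InF : *ℕ → *ℕ → Set
  InF p x = x <* p

{-# OPTIONS --safe #-}

-- f_ℚ(x) is the least height max(|N|, |M|) of an integer fraction N/M ≡ x (mod p̂) with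
-- p̂ ∤ M; the sign ± of the definition is absorbed into N and M.  If N/M and N′/M′
-- represent a and b, then (N M′ + N′ M)/(M M′) and N N′/(M M′) represent a + b and a b,
-- with heights at most 2 h h′ and h h′, and p̂ ∤ M M′ because p̂ is prime.  Negation
-- -N/M and inversion M/N preserve heights, so applying them to a minimal fraction and
-- back gives equality.  All of this happens index-wise on members of the ultrafilter;
-- only the primality of p̂ and a < p̂ are used, not countable incompleteness or the
-- nonstandardness of p̂.

module Submission where

open import Data.Empty using (⊥-elim)
open import Data.Integer.Base using (ℤ; +_; -[1+_]; ∣_∣; _+_; _-_; _*_; -_)
import Data.Integer.Properties as ℤ
open import Data.Integer.Divisibility.Signed
  using (_∣_; divides; ∣ᵤ⇒∣; ∣⇒∣ᵤ; ∣-refl; ∣m∣n⇒∣m+n; ∣m⇒∣-m; ∣m⇒∣m*n; ∣n⇒∣m*n)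
open import Data.Integer.Tactic.RingSolver using (solve)
open import Data.List.Base using ([]; _∷_)
open import Data.Nat.Base as ℕ using (ℕ; suc; _⊔_; _≤_)
import Data.Nat.Properties as ℕ
import Data.Nat.Divisibility as ℕ using (_∣_)
import Data.Nat.Tactic.RingSolver as ℕ-Solver
open import Data.Nat.Primality using (Prime; euclidsLemma)
open import Data.Product using (Σ; _×_; _,_)
open import Data.Sum using (_⊎_; inj₁; inj₂)
open import Relation.Binary.Bundles using (Setoid)
open import Relation.Binary.PropositionalEquality
  using (_≡_; refl; sym; trans; cong; cong₂; subst; subst₂; module ≡-Reasoning)
import Relation.Binary.Reasoning.Setoid as ≈-Reasoning
open import Relation.Nullary using (¬_)

open import Defs

infix 4 _≡_[mod_] _≡_/_[mod_]

record _≡_[mod_] (X Y : ℤ) (q : ℕ) : Set where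
  constructor mod-divides
  field
    divides-difference : + q ∣ X - Y

record _≡_/_[mod_] (X N M : ℤ) (q : ℕ) : Set where
  constructor cross-multiplied
  field
    cross : X * M ≡ N [mod q ]

open _≡_/_[mod_]

module _ {q : ℕ} where

  private
    ∣-by : ∀ D {X Y} → D ≡ X - Y → + q ∣ D → X ≡ Y [mod q ]
    ∣-by _ eq d = mod-divides (subst (+ q ∣_) eq d)

  ≡-mod-refl : ∀ {X} → X ≡ X [mod q ]
  ≡-mod-refl {X} = ∣-by (+ 0) (sym (ℤ.+-inverseʳ X)) (divides (+ 0) refl)

  ≡-mod-sym : ∀ {X Y} → X ≡ Y [mod q ] → Y ≡ X [mod q ]
  ≡-mod-sym {X} {Y} (mod-divides d) = ∣-by (- (X - Y)) (solve (X ∷ Y ∷ [])) (∣m⇒∣-m d)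

  ≡-mod-trans : ∀ {X Y Z} → X ≡ Y [mod q ] → Y ≡ Z [mod q ] → X ≡ Z [mod q ]
  ≡-mod-trans {X} {Y} {Z} (mod-divides d) (mod-divides e) =
    ∣-by ((X - Y) + (Y - Z)) (solve (X ∷ Y ∷ Z ∷ [])) (∣m∣n⇒∣m+n d e)

  ≡-mod-respˡ : ∀ {X X′ Y} → X ≡ X′ → X ≡ Y [mod q ] → X′ ≡ Y [mod q ]
  ≡-mod-respˡ refl x≡y = x≡y

  /-respˡ : ∀ {X X′ N M} → X ≡ X′ → X ≡ N / M [mod q ] → X′ ≡ N / M [mod q ]
  /-respˡ refl x≡ = x≡

  +-cong-mod : ∀ {X X′ Y Y′} → X ≡ X′ [mod q ] → Y ≡ Y′ [mod q ] → X + Y ≡ X′ + Y′ [mod q ]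
  +-cong-mod {X} {X′} {Y} {Y′} (mod-divides d) (mod-divides e) =
    ∣-by ((X - X′) + (Y - Y′)) (solve (X ∷ X′ ∷ Y ∷ Y′ ∷ [])) (∣m∣n⇒∣m+n d e)

  -‿cong-mod : ∀ {X X′} → X ≡ X′ [mod q ] → - X ≡ - X′ [mod q ]
  -‿cong-mod {X} {X′} (mod-divides d) = ∣-by (- (X - X′)) (solve (X ∷ X′ ∷ [])) (∣m⇒∣-m d)

  *-cong-mod : ∀ {X X′ Y Y′} → X ≡ X′ [mod q ] → Y ≡ Y′ [mod q ] → X * Y ≡ X′ * Y′ [mod q ]
  *-cong-mod {X} {X′} {Y} {Y′} (mod-divides d) (mod-divides e) =
    ∣-by ((X - X′) * Y + X′ * (Y - Y′)) (solve (X ∷ X′ ∷ Y ∷ Y′ ∷ []))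
      (∣m∣n⇒∣m+n (∣m⇒∣m*n Y d) (∣n⇒∣m*n X′ e))

  ∣⇒≡0-mod : ∀ {X} → + q ∣ X → X ≡ + 0 [mod q ]
  ∣⇒≡0-mod {X} = ∣-by X (sym (ℤ.+-identityʳ X))

  ≡0-mod⇒∣ : ∀ {X} → X ≡ + 0 [mod q ] → + q ∣ X
  ≡0-mod⇒∣ {X} (mod-divides d) = subst (+ q ∣_) (ℤ.+-identityʳ X) d

≡-mod-setoid : ℕ → Setoid _ _
≡-mod-setoid q = record
  { Carrier       = ℤ
  ; _≈_           = λ X Y → X ≡ Y [mod q ]
  ; isEquivalence = record { refl = ≡-mod-refl ; sym = ≡-mod-sym ; trans = ≡-mod-trans }
  }

module _ {q : ℕ} where
  open ≈-Reasoning (≡-mod-setoid q)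

  +≡0⇒≡- : ∀ {X N} → X + N ≡ + 0 [mod q ] → X ≡ - N [mod q ]
  +≡0⇒≡- {X} {N} x+n≡0 = begin
    X             ≡⟨ solve (X ∷ N ∷ []) ⟩
    X + N + - N   ≈⟨ +-cong-mod x+n≡0 ≡-mod-refl ⟩
    + 0 + - N     ≡⟨ ℤ.+-identityˡ (- N) ⟩
    - N           ∎

  ≡-⇒+≡0 : ∀ {X N} → X ≡ - N [mod q ] → X + N ≡ + 0 [mod q ]
  ≡-⇒+≡0 {X} {N} x≡-n = begin
    X + N         ≈⟨ +-cong-mod x≡-n ≡-mod-refl ⟩
    - N + N       ≡⟨ ℤ.+-inverseˡ N ⟩
    + 0           ∎

  /-+ : ∀ {X Y A B Ma Mb} → X ≡ A / Ma [mod q ] → Y ≡ B / Mb [mod q ] →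
        X + Y ≡ A * Mb + B * Ma / Ma * Mb [mod q ]
  /-+ {X} {Y} {A} {B} {Ma} {Mb} x≡ y≡ = cross-multiplied (begin
    (X + Y) * (Ma * Mb)       ≡⟨ solve (X ∷ Y ∷ Ma ∷ Mb ∷ []) ⟩
    X * Ma * Mb + Y * Mb * Ma ≈⟨ +-cong-mod (*-cong-mod (cross x≡) ≡-mod-refl)
                                            (*-cong-mod (cross y≡) ≡-mod-refl) ⟩
    A * Mb + B * Ma           ∎)

  /-* : ∀ {X Y A B Ma Mb} → X ≡ A / Ma [mod q ] → Y ≡ B / Mb [mod q ] →
        X * Y ≡ A * B / Ma * Mb [mod q ]
  /-* {X} {Y} {A} {B} {Ma} {Mb} x≡ y≡ = cross-multiplied (begin
    X * Y * (Ma * Mb)   ≡⟨ solve (X ∷ Y ∷ Ma ∷ Mb ∷ []) ⟩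
    X * Ma * (Y * Mb)   ≈⟨ *-cong-mod (cross x≡) (cross y≡) ⟩
    A * B               ∎)

  /-neg : ∀ {X Y N M} → X + Y ≡ + 0 [mod q ] → X ≡ N / M [mod q ] → Y ≡ - N / M [mod q ]
  /-neg {X} {Y} {N} {M} x+y≡0 x≡ = cross-multiplied (begin
    Y * M                 ≡⟨ solve (X ∷ Y ∷ M ∷ []) ⟩
    (X + Y) * M - X * M   ≈⟨ +-cong-mod (*-cong-mod x+y≡0 ≡-mod-refl) (-‿cong-mod (cross x≡)) ⟩
    + 0 * M - N           ≡⟨ solve (M ∷ N ∷ []) ⟩
    - N                   ∎)

  /-recip : ∀ {X C N M} → X ≡ + 1 / C [mod q ] → X ≡ N / M [mod q ] → C ≡ M / N [mod q ]
  /-recip {X} {C} {N} {M} xc≡1 x≡ = cross-multiplied (begin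
    C * N         ≈⟨ *-cong-mod (≡-mod-refl {X = C}) (≡-mod-sym (cross x≡)) ⟩
    C * (X * M)   ≡⟨ solve (X ∷ C ∷ M ∷ []) ⟩
    X * C * M     ≈⟨ *-cong-mod (cross xc≡1) ≡-mod-refl ⟩
    + 1 * M       ≡⟨ ℤ.*-identityˡ M ⟩
    M             ∎)

  /-sign : ∀ {X N M} → X ≡ N / M [mod q ] → X ≡ - N / - M [mod q ]
  /-sign {X} {N} {M} x≡ = cross-multiplied (begin
    X * - M       ≡⟨ ℤ.neg-distribʳ-* X M ⟨
    - (X * M)     ≈⟨ -‿cong-mod (cross x≡) ⟩
    - N           ∎)

  /-∣num : ∀ {X N M} → X ≡ N / M [mod q ] → + q ∣ M → + q ∣ N
  /-∣num {X} {N} {M} x≡ q∣M = ≡0-mod⇒∣ (begin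
    N             ≈⟨ ≡-mod-sym (cross x≡) ⟩
    X * M         ≈⟨ *-cong-mod (≡-mod-refl {X = X}) (∣⇒≡0-mod q∣M) ⟩
    X * + 0       ≡⟨ ℤ.*-zeroʳ X ⟩
    + 0           ∎)

private
  shifts⇒difference : ∀ X Y K L Q → X + K * Q ≡ Y + L * Q → X - Y ≡ (L - K) * Q
  shifts⇒difference X Y K L Q eq = begin
    X - Y                             ≡⟨ solve (X ∷ Y ∷ K ∷ L ∷ Q ∷ []) ⟩
    (X + K * Q) - Y - K * Q           ≡⟨ cong (λ Z → Z - Y - K * Q) eq ⟩
    (Y + L * Q) - Y - K * Q           ≡⟨ solve (X ∷ Y ∷ K ∷ L ∷ Q ∷ []) ⟩
    (L - K) * Q                       ∎
    where open ≡-Reasoning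

  difference⇒shifts : ∀ X Y K L Q → X - Y ≡ (L - K) * Q → X + K * Q ≡ Y + L * Q
  difference⇒shifts X Y K L Q eq = begin
    X + K * Q                         ≡⟨ solve (X ∷ Y ∷ K ∷ L ∷ Q ∷ []) ⟩
    (X - Y) + Y + K * Q               ≡⟨ cong (λ Z → Z + Y + K * Q) eq ⟩
    (L - K) * Q + Y + K * Q           ≡⟨ solve (X ∷ Y ∷ K ∷ L ∷ Q ∷ []) ⟩
    Y + L * Q                         ∎
    where open ≡-Reasoning

  pos-+-* : ∀ a k q → + (a ℕ.+ k ℕ.* q) ≡ + a + + k * + q
  pos-+-* a k q = trans (ℤ.pos-+ a (k ℕ.* q)) (cong (λ Z → + a + Z) (ℤ.pos-* k q))

  pos-*-+ : ∀ x m n → + (x ℕ.* m ℕ.+ n) ≡ + x * + m + + n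
  pos-*-+ x m n = trans (ℤ.pos-+ (x ℕ.* m) n) (cong (_+ + n) (ℤ.pos-* x m))

  pos-minus-pos : ∀ K → Σ ℕ λ l → Σ ℕ λ k → K ≡ + l - + k
  pos-minus-pos (+ l)     = l , 0 , sym (ℤ.+-identityʳ (+ l))
  pos-minus-pos -[1+ k ]  = 0 , suc k , refl

Cong⇒≡-mod : ∀ {q a b} → Cong q a b → + a ≡ + b [mod q ]
Cong⇒≡-mod {q} {a} {b} (k , l , eq) = mod-divides (divides (+ l - + k)
  (shifts⇒difference (+ a) (+ b) (+ k) (+ l) (+ q)
    (trans (sym (pos-+-* a k q)) (trans (cong +_ eq) (pos-+-* b l q)))))

≡-mod⇒Cong : ∀ {q a b} → + a ≡ + b [mod q ] → Cong q a b
≡-mod⇒Cong {q} {a} {b} (mod-divides (divides K eq)) with pos-minus-pos K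
... | l , k , refl = k , l , ℤ.+-injective
  (trans (pos-+-* a k q)
    (trans (difference⇒shifts (+ a) (+ b) (+ k) (+ l) (+ q) eq) (sym (pos-+-* b l q))))

module _ {q x : ℕ} where

  Cong⇒/ : ∀ {n m} → Cong q (x ℕ.* m) n → + x ≡ + n / + m [mod q ]
  Cong⇒/ {n} {m} c = cross-multiplied (≡-mod-respˡ (ℤ.pos-* x m) (Cong⇒≡-mod c))

  Cong⇒-/ : ∀ {n m} → Cong q (x ℕ.* m ℕ.+ n) 0 → + x ≡ - + n / + m [mod q ]
  Cong⇒-/ {n} {m} c =
    cross-multiplied (+≡0⇒≡- (≡-mod-respˡ (pos-*-+ x m n) (Cong⇒≡-mod c)))

  /⇒Cong⁺ : ∀ {N m} → + x ≡ N / + m [mod q ] →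
            Cong q (x ℕ.* m) ∣ N ∣ ⊎ Cong q (x ℕ.* m ℕ.+ ∣ N ∣) 0
  /⇒Cong⁺ {+ n} {m} x≡ =
    inj₁ (≡-mod⇒Cong (≡-mod-respˡ (sym (ℤ.pos-* x m)) (cross x≡)))
  /⇒Cong⁺ { -[1+ n ]} {m} x≡ =
    inj₂ (≡-mod⇒Cong (≡-mod-respˡ (sym (pos-*-+ x m (suc n))) (≡-⇒+≡0 (cross x≡))))

  /⇒Cong : ∀ {N M} → + x ≡ N / M [mod q ] →
           Cong q (x ℕ.* ∣ M ∣) ∣ N ∣ ⊎ Cong q (x ℕ.* ∣ M ∣ ℕ.+ ∣ N ∣) 0
  /⇒Cong {N} {+ m}      x≡ = /⇒Cong⁺ x≡
  /⇒Cong {N} { -[1+ m ]} x≡ =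
    subst (λ n → Cong q (x ℕ.* suc m) n ⊎ Cong q (x ℕ.* suc m ℕ.+ n) 0)
      (ℤ.∣-i∣≡∣i∣ N) (/⇒Cong⁺ (/-sign x≡))

euclidsLemma-∣*∣ : ∀ {p} M M′ → Prime p → p ℕ.∣ ∣ M * M′ ∣ → p ℕ.∣ ∣ M ∣ ⊎ p ℕ.∣ ∣ M′ ∣
euclidsLemma-∣*∣ M M′ prime p∣MM′ =
  euclidsLemma _ _ prime (subst (_ ℕ.∣_) (ℤ.abs-* M M′) p∣MM′)

height : ℤ → ℤ → ℕ
height N M = ∣ N ∣ ⊔ ∣ M ∣

module _ (A Ma B Mb : ℤ) where

  private
    hA hB : ℕ
    hA = height A Ma
    hB = height B Mb

    A≤ : ∣ A ∣ ≤ hA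
    A≤ = ℕ.m≤m⊔n ∣ A ∣ ∣ Ma ∣
    Ma≤ : ∣ Ma ∣ ≤ hA
    Ma≤ = ℕ.m≤n⊔m ∣ A ∣ ∣ Ma ∣
    B≤ : ∣ B ∣ ≤ hB
    B≤ = ℕ.m≤m⊔n ∣ B ∣ ∣ Mb ∣
    Mb≤ : ∣ Mb ∣ ≤ hB
    Mb≤ = ℕ.m≤n⊔m ∣ B ∣ ∣ Mb ∣

    den-bound : ∣ Ma * Mb ∣ ≤ hA ℕ.* hB
    den-bound = ℕ.≤-trans (ℕ.≤-reflexive (ℤ.abs-* Ma Mb)) (ℕ.*-mono-≤ Ma≤ Mb≤)

  height-* : height (A * B) (Ma * Mb) ≤ height A Ma ℕ.* height B Mb
  height-* = ℕ.⊔-lub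
    (ℕ.≤-trans (ℕ.≤-reflexive (ℤ.abs-* A B)) (ℕ.*-mono-≤ A≤ B≤))
    den-bound

  height-+ : height (A * Mb + B * Ma) (Ma * Mb) ≤ 2 ℕ.* height A Ma ℕ.* height B Mb
  height-+ = ℕ.⊔-lub
    (begin
      ∣ A * Mb + B * Ma ∣                   ≤⟨ ℤ.∣i+j∣≤∣i∣+∣j∣ (A * Mb) (B * Ma) ⟩
      ∣ A * Mb ∣ ℕ.+ ∣ B * Ma ∣             ≡⟨ cong₂ ℕ._+_ (ℤ.abs-* A Mb) (ℤ.abs-* B Ma) ⟩
      ∣ A ∣ ℕ.* ∣ Mb ∣ ℕ.+ ∣ B ∣ ℕ.* ∣ Ma ∣ ≤⟨ ℕ.+-mono-≤ (ℕ.*-mono-≤ A≤ Mb≤) (ℕ.*-mono-≤ B≤ Ma≤) ⟩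
      hA ℕ.* hB ℕ.+ hB ℕ.* hA               ≡⟨ twice hA hB ⟩
      2 ℕ.* hA ℕ.* hB                       ∎)
    (begin
      ∣ Ma * Mb ∣                           ≤⟨ den-bound ⟩
      hA ℕ.* hB                             ≤⟨ ℕ.m≤m+n (hA ℕ.* hB) (hB ℕ.* hA) ⟩
      hA ℕ.* hB ℕ.+ hB ℕ.* hA               ≡⟨ twice hA hB ⟩
      2 ℕ.* hA ℕ.* hB                       ∎)
    where
    open ℕ.≤-Reasoning
    twice : ∀ a b → a ℕ.* b ℕ.+ b ℕ.* a ≡ 2 ℕ.* a ℕ.* b
    twice = ℕ-Solver.solve-∀

module Fractions {I : Set} (F : Ultrafilter I) where
  open Ultrapower F

  U-zipWith : ∀ {P Q R : I → Set} → (∀ i → P i → Q i → R i) → U F P → U F Q → U F R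
  U-zipWith f u v = mono F (λ i (pᵢ , qᵢ) → f i pᵢ qᵢ) (inter F u v)

  U-zipWith₃ : ∀ {P Q R S : I → Set} → (∀ i → P i → Q i → R i → S i) →
               U F P → U F Q → U F R → U F S
  U-zipWith₃ f u v w = U-zipWith (λ i (pᵢ , qᵢ) → f i pᵢ qᵢ) (inter F u v) w

  U-⊎ : ∀ {P Q : I → Set} → U F (λ i → P i ⊎ Q i) → U F P ⊎ U F Q
  U-⊎ {P} u with ultra F P
  ... | inj₁ uP  = inj₁ uP
  ... | inj₂ u¬P = inj₂ (U-zipWith (λ { _ (inj₁ p) ¬p → ⊥-elim (¬p p)
                                      ; _ (inj₂ q) _  → q }) u u¬P)

  ≤*-antisym : ∀ {x y} → x ≤* y → y ≤* x → x ≈* y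
  ≤*-antisym = U-zipWith (λ _ → ℕ.≤-antisym)

  NonZeroMod-∣*∣ : ∀ {p} (M M′ : I → ℤ) → U F (λ i → Prime (p i)) →
                   NonZeroMod p (λ i → ∣ M i ∣) → NonZeroMod p (λ i → ∣ M′ i ∣) →
                   NonZeroMod p (λ i → ∣ M i * M′ i ∣)
  NonZeroMod-∣*∣ M M′ prime M≢0 M′≢0 p∣MM′
    with U-⊎ (U-zipWith (λ i → euclidsLemma-∣*∣ (M i) (M′ i)) prime p∣MM′)
  ... | inj₁ p∣M  = M≢0 p∣M
  ... | inj₂ p∣M′ = M′≢0 p∣M′

  record Fraction (p x : *ℕ) : Set where
    field
      num den    : I → ℤ
      represents : U F (λ i → + x i ≡ num i / den i [mod p i ])
      den≢0      : NonZeroMod p (λ i → ∣ den i ∣)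

    height* : *ℕ
    height* i = height (num i) (den i)

  open Fraction

  /⇒RatRep : ∀ {p x : *ℕ} {N M : I → ℤ} → U F (λ i → + x i ≡ N i / M i [mod p i ]) →
             RatRep p x (λ i → ∣ N i ∣) (λ i → ∣ M i ∣)
  /⇒RatRep u = U-⊎ (mono F (λ _ → /⇒Cong) u)

  RatRep⇒/ : ∀ {p x n m} → RatRep p x n m →
             Σ (I → ℤ) λ N → (∀ i → ∣ N i ∣ ≡ n i) × U F (λ i → + x i ≡ N i / + m i [mod p i ])
  RatRep⇒/ {n = n} (inj₁ u) = (λ i → + n i) , (λ _ → refl) , mono F (λ _ → Cong⇒/) u
  RatRep⇒/ {n = n} (inj₂ u) =
    (λ i → - + n i) , (λ i → ℤ.∣-i∣≡∣i∣ (+ n i)) , mono F (λ _ → Cong⇒-/) u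

  IsFQ-≤-height : ∀ {p x v} → IsFQ p x v → (r : Fraction p x) → v ≤* height* r
  IsFQ-≤-height (_ , minimal) r = minimal _ _ (den≢0 r) (/⇒RatRep (represents r))

  IsFQ-attained : ∀ {p x v} → IsFQ p x v → Σ (Fraction p x) λ r → v ≈* height* r
  IsFQ-attained ((n , m , m≢0 , rep , v≈n⊔m) , _) with RatRep⇒/ rep
  ... | N , ∣N∣≡n , N/m =
    record { num = N ; den = λ i → + m i ; represents = N/m ; den≢0 = m≢0 } ,
    mono F (λ i v≡ → trans v≡ (cong (_⊔ m i) (sym (∣N∣≡n i)))) v≈n⊔m

  IsFQ-≤-map : ∀ {p x y vx vy} (f : Fraction p x → Fraction p y) →
               (∀ r i → height* (f r) i ≤ height* r i) →
               IsFQ p x vx → IsFQ p y vy → vy ≤* vx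
  IsFQ-≤-map f f-height fx fy with IsFQ-attained fx
  ... | r , vx≈ = U-zipWith
    (λ i vy≤ vx≡ → ℕ.≤-trans vy≤ (ℕ.≤-trans (f-height r i) (ℕ.≤-reflexive (sym vx≡))))
    (IsFQ-≤-height fy (f r)) vx≈

  IsFQ-≤-map₂ : ∀ {p x y z vx vy vz} (g : ℕ → ℕ → ℕ)
                (f : Fraction p x → Fraction p y → Fraction p z) →
                (∀ r s i → height* (f r s) i ≤ g (height* r i) (height* s i)) →
                IsFQ p x vx → IsFQ p y vy → IsFQ p z vz → vz ≤* (λ i → g (vx i) (vy i))
  IsFQ-≤-map₂ g f f-height fx fy fz with IsFQ-attained fx | IsFQ-attained fy
  ... | r , vx≈ | s , vy≈ = U-zipWith₃
    (λ i vz≤ vx≡ vy≡ → ℕ.≤-trans vz≤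
      (subst₂ (λ a b → _ ≤ g a b) (sym vx≡) (sym vy≡) (f-height r s i)))
    (IsFQ-≤-height fz (f r s)) vx≈ vy≈

  module _ {p : *ℕ} (prime : U F (λ i → Prime (p i))) {x y : *ℕ} where

    _+ᶠ_ : Fraction p x → Fraction p y → Fraction p (x +* y)
    r +ᶠ s = record
      { num        = λ i → num r i * den s i + num s i * den r i
      ; den        = λ i → den r i * den s i
      ; represents = U-zipWith
          (λ i x≡ y≡ → /-respˡ (sym (ℤ.pos-+ (x i) (y i))) (/-+ x≡ y≡))
          (represents r) (represents s)
      ; den≢0      = NonZeroMod-∣*∣ (den r) (den s) prime (den≢0 r) (den≢0 s)
      }

    _*ᶠ_ : Fraction p x → Fraction p y → Fraction p (x ** y)
    r *ᶠ s = record
      { num        = λ i → num r i * num s i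
      ; den        = λ i → den r i * den s i
      ; represents = U-zipWith
          (λ i x≡ y≡ → /-respˡ (sym (ℤ.pos-* (x i) (y i))) (/-* x≡ y≡))
          (represents r) (represents s)
      ; den≢0      = NonZeroMod-∣*∣ (den r) (den s) prime (den≢0 r) (den≢0 s)
      }

    IsFQ-+ : ∀ {vx vy vs} → IsFQ p x vx → IsFQ p y vy → IsFQ p (x +* y) vs →
             vs ≤* ((const 2 ** vx) ** vy)
    IsFQ-+ = IsFQ-≤-map₂ (λ u v → 2 ℕ.* u ℕ.* v) _+ᶠ_
               (λ r s i → height-+ (num r i) (den r i) (num s i) (den s i))

    IsFQ-* : ∀ {vx vy vs} → IsFQ p x vx → IsFQ p y vy → IsFQ p (x ** y) vs → vs ≤* (vx ** vy)
    IsFQ-* = IsFQ-≤-map₂ ℕ._*_ _*ᶠ_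
               (λ r s i → height-* (num r i) (den r i) (num s i) (den s i))

  module _ {p : *ℕ} where

    negᶠ : ∀ {x y} → U F (λ i → x i ℕ.+ y i ≡ p i) → Fraction p x → Fraction p y
    negᶠ {x} {y} x+y≡p r = record
      { num        = λ i → - num r i
      ; den        = den r
      ; represents = U-zipWith (λ i x+y≡p x≡ → /-neg (x+y≡0 x+y≡p) x≡) x+y≡p (represents r)
      ; den≢0      = den≢0 r
      }
      where
      x+y≡0 : ∀ {i} → x i ℕ.+ y i ≡ p i → + x i + + y i ≡ + 0 [mod p i ]
      x+y≡0 {i} eq =
        ∣⇒≡0-mod (subst (+ p i ∣_) (trans (cong +_ (sym eq)) (ℤ.pos-+ (x i) (y i))) ∣-refl)

    recipᶠ : ∀ {x y} → CongP p (x ** y) (const 1) → Fraction p x → Fraction p y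
    recipᶠ {x} {y} xy≡1 r = record
      { num        = den r
      ; den        = num r
      ; represents = y≡
      ; den≢0      = λ p∣num →
          den≢0 r (U-zipWith (λ i y≡ p∣ → ∣⇒∣ᵤ (/-∣num y≡ (∣ᵤ⇒∣ p∣))) y≡ p∣num)
      }
      where
      y≡ : U F (λ i → + y i ≡ den r i / num r i [mod p i ])
      y≡ = U-zipWith (λ i xy≡1 x≡ → /-recip (Cong⇒/ xy≡1) x≡) xy≡1 (represents r)

    module _ {x y vx vy : *ℕ} where

      IsFQ-neg : U F (λ i → x i ℕ.+ y i ≡ p i) → IsFQ p x vx → IsFQ p y vy → vy ≈* vx
      IsFQ-neg x+y≡p fx fy = ≤*-antisym
        (IsFQ-≤-map (negᶠ {x} {y} x+y≡p) (λ r i → ℕ.≤-reflexive (height*-neg r i)) fx fy)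
        (IsFQ-≤-map (negᶠ {y} {x} y+x≡p) (λ r i → ℕ.≤-reflexive (height*-neg r i)) fy fx)
        where
        y+x≡p : U F (λ i → y i ℕ.+ x i ≡ p i)
        y+x≡p = mono F (λ i → trans (ℕ.+-comm (y i) (x i))) x+y≡p
        height*-neg : ∀ {z} (r : Fraction p z) i → ∣ - num r i ∣ ⊔ ∣ den r i ∣ ≡ height* r i
        height*-neg r i = cong (_⊔ ∣ den r i ∣) (ℤ.∣-i∣≡∣i∣ (num r i))

      IsFQ-recip : CongP p (x ** y) (const 1) → IsFQ p x vx → IsFQ p y vy → vy ≈* vx
      IsFQ-recip xy≡1 fx fy = ≤*-antisym
        (IsFQ-≤-map (recipᶠ {x} {y} xy≡1) (λ r i → ℕ.≤-reflexive (height*-swap r i)) fx fy)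
        (IsFQ-≤-map (recipᶠ {y} {x} yx≡1) (λ r i → ℕ.≤-reflexive (height*-swap r i)) fy fx)
        where
        yx≡1 : CongP p (y ** x) (const 1)
        yx≡1 = mono F (λ i → subst (λ z → Cong (p i) z 1) (ℕ.*-comm (x i) (y i))) xy≡1
        height*-swap : ∀ {z} (r : Fraction p z) i → ∣ den r i ∣ ⊔ ∣ num r i ∣ ≡ height* r i
        height*-swap r i = ℕ.⊔-comm ∣ den r i ∣ ∣ num r i ∣

proposition1p2 : (I : Set) (F : Ultrafilter I) → CountablyIncomplete F →
    let open Ultrapower F in
    (p : *ℕ) → NonstandardPrime p →
    (a b : *ℕ) → InF p a → InF p b →
      (∀ (va vb vs : *ℕ) → IsFQ p a va → IsFQ p b vb → IsFQ p (a +* b) vs →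
         vs ≤* ((const 2 ** va) ** vb))
      × (∀ (va vb vs : *ℕ) → IsFQ p a va → IsFQ p b vb → IsFQ p (a ** b) vs →
         vs ≤* (va ** vb))
      × (∀ (va vn : *ℕ) → IsFQ p a va → IsFQ p (p ∸* a) vn → vn ≈* va)
      × (¬ (a ≈* const 0) → ∀ (c : *ℕ) → InF p c → CongP p (a ** c) (const 1) →
         ∀ (va vc : *ℕ) → IsFQ p a va → IsFQ p c vc → vc ≈* va)
proposition1p2 I F _ p (prime , _) a b a<p _ =
    (λ _ _ _ → IsFQ-+ prime {a} {b})
  , (λ _ _ _ → IsFQ-* prime {a} {b})
  , (λ _ _ → IsFQ-neg {x = a} (mono F (λ _ a<p → ℕ.m+[n∸m]≡n (ℕ.<⇒≤ a<p)) a<p))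
  , (λ _ c _ ac≡1 _ _ → IsFQ-recip {x = a} {c} ac≡1)
  where
  open Fractions F
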